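{- Let $n$ be a positive integer. The following system in the variables $x_1,\ldots,x_{n+10}$: \[ \begin{array}{rcl} x_i \cdot x_i & = & x_{i+1} \quad \text{for every } i \in \{1,\ldots,n\},\\ x_1 \cdot x_{n+1} & = & x_{n+2},\\ x_{n+3} & = & 1,\\ x_{n+3}+x_{n+3} & = & x_{n+4},\\ x_{n+4}+x_{n+4} & = & x_{n+5},\\ x_{n+5}+x_{n+3} & = & x_1,\\ x_{n+6} \cdot x_{n+6} & = & x_{n+7},\\ x_{n+8} \cdot x_{n+8} & = & x_{n+9},\\ x_{n+9}+x_{n+3} & = & x_{n+10},\\ x_{n+2} \cdot x_{n+7} & = & x_{n+10} \end{array} \] has infinitely many solutions in non-negative integers $x_1,\ldots,x_{n+10}$. Moreover, if an integer tuple $(x_1,\ldots,x_{n+10})$ solves the system, then \[ x_{n+10} \geq \left(\frac{\left(2+\sqrt{5}\right)^{5^{2^{n-1}}}+\left(2-\sqrt{5}\right)^{5^{2^{n-1}}}}{2}\right)^2+1 . \] -}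

module Defs where

open import Data.Nat as ℕ using (ℕ; zero; suc)
open import Data.Fin using (Fin; fromℕ<)
open import Data.Integer as ℤ using (ℤ; +_)
open import Data.Product using (_×_)
open import Relation.Binary.PropositionalEquality using (_≡_)
open import Relation.Nullary using (yes; no)

-- 1-based access to a tuple (x₁,…,x_m) represented as Fin m → ℤ:
-- x ‼ i = x_i for 1 ≤ i ≤ m (index i-1 in Fin m); out of range gives 0
-- (never used: every index occurring in the system is in range).
infixl 9 _‼_
_‼_ : ∀ {m} → (Fin m → ℤ) → ℕ → ℤ
_‼_ x zero = + 0
_‼_ {m} x (suc i) with i ℕ.<? m
... | yes p = x (fromℕ< p)
... | no _ = + 0

System : (n : ℕ) → (Fin (n ℕ.+ 10) → ℤ) → Set
System n x =
  (∀ i → 1 ℕ.≤ i → i ℕ.≤ n → x ‼ i ℤ.* x ‼ i ≡ x ‼ (suc i)) ×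
  (x ‼ 1 ℤ.* x ‼ (n ℕ.+ 1) ≡ x ‼ (n ℕ.+ 2)) ×
  (x ‼ (n ℕ.+ 3) ≡ + 1) ×
  (x ‼ (n ℕ.+ 3) ℤ.+ x ‼ (n ℕ.+ 3) ≡ x ‼ (n ℕ.+ 4)) ×
  (x ‼ (n ℕ.+ 4) ℤ.+ x ‼ (n ℕ.+ 4) ≡ x ‼ (n ℕ.+ 5)) ×
  (x ‼ (n ℕ.+ 5) ℤ.+ x ‼ (n ℕ.+ 3) ≡ x ‼ 1) ×
  (x ‼ (n ℕ.+ 6) ℤ.* x ‼ (n ℕ.+ 6) ≡ x ‼ (n ℕ.+ 7)) ×
  (x ‼ (n ℕ.+ 8) ℤ.* x ‼ (n ℕ.+ 8) ≡ x ‼ (n ℕ.+ 9)) ×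
  (x ‼ (n ℕ.+ 9) ℤ.+ x ‼ (n ℕ.+ 3) ≡ x ‼ (n ℕ.+ 10)) ×
  (x ‼ (n ℕ.+ 2) ℤ.* x ‼ (n ℕ.+ 7) ≡ x ‼ (n ℕ.+ 10))

toℤ : ∀ {m} → (Fin m → ℕ) → (Fin m → ℤ)
toℤ y t = + (y t)

-- The ring ℤ[√5]: (a +√5· b) denotes a + b·√5.
record ℤ√5 : Set where
  constructor _+√5·_
  field
    re : ℤ
    im : ℤ
infix 5 _+√5·_
open ℤ√5 public

_⊕_ : ℤ√5 → ℤ√5 → ℤ√5
(a +√5· b) ⊕ (c +√5· d) = (a ℤ.+ c) +√5· (b ℤ.+ d)

_⊗_ : ℤ√5 → ℤ√5 → ℤ√5
(a +√5· b) ⊗ (c +√5· d) = (a ℤ.* c ℤ.+ + 5 ℤ.* (b ℤ.* d)) +√5· (a ℤ.* d ℤ.+ b ℤ.* c)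

_^√_ : ℤ√5 → ℕ → ℤ√5
u ^√ zero = + 1 +√5· + 0
u ^√ suc k = u ⊗ (u ^√ k)

lucasSum : ℕ → ℤ√5
lucasSum m = ((+ 2 +√5· + 1) ^√ m) ⊕ ((+ 2 +√5· ℤ.- (+ 1)) ^√ m)

module Submission where

-- Write (2 + √5)^k = Z k + W k·√5 with Z k, W k ∈ ℕ.  The pairs (Z k, W k)
-- are exactly the natural solutions of a² − 5b² = ±1, the sign being (−1)^k.  Next come two
-- 5-adic facts: 5^j ∣ W k forces 5^j ∣ k, while 5^e ∣ W (5^e · t) always.
-- Together they give a lower bound and an infinite family:
--   * if a² + 1 = 5b² and 5^e ∣ b, then a ≥ Z (5^e);
--   * for k = 5^e(2j + 1) (odd), Z k² + 1 = 5 W k² and 5^e ∣ W k.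
-- Finally the system is read off: it forces x₁ = 5, x_{i+1} = x_i², hence
-- x_{n+2} = 5c² with c = 5^(2^(n−1)), and x_{n+10} = A² + 1 = 5(c·B)² with
-- A = |x_{n+8}|, B = |x_{n+6}|.  The lower bound gives A ≥ Z c, and the Lucas
-- sum (2+√5)^c + (2−√5)^c equals 2·Z c, which is the claimed bound; the
-- family yields infinitely many non-negative solutions.

open import Defs
open import Data.Nat as ℕ using (ℕ; _≤_; _∸_; _^_)
open import Data.Fin using (Fin)
open import Data.Integer as ℤ using (ℤ; +_)
open import Data.Product using (_×_; Σ)
open import Relation.Binary.PropositionalEquality using (_≡_)

open import Data.Fin using (toℕ; fromℕ<)
open import Data.Fin.Properties using (toℕ-fromℕ<)
open import Data.Nat using (zero; suc; _+_; _*_; _<_; _<?_; _≤?_; z≤n; s≤s; _≤′_; ≤′-refl; ≤′-step)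
open import Data.Nat.Properties
open import Data.Nat.Tactic.RingSolver using (solve-∀)
open import Data.Product using (_,_; proj₁; proj₂; ∃-syntax)
open import Data.Sum using (_⊎_; inj₁; inj₂)
open import Data.Empty using (⊥-elim)
open import Data.Nat.Induction using (<-rec)
open import Data.Nat.Divisibility using (_∣_; divides; _∣?_; _∣0; 1∣_; ∣-refl; ∣-trans; ∣⇒≤; ∣m∣n⇒∣m+n; ∣m+n∣m⇒∣n; m∣m*n; n∣m*n; ∣m⇒∣m*n; ∣n⇒∣m*n; *-monoʳ-∣; *-cancelˡ-∣)
open import Data.Nat.Primality using (Prime; prime?; euclidsLemma; prime⇒nonZero)
open import Relation.Nullary.Decidable using (True; toWitness; from-yes; from-no)
import Data.Integer.Properties as ℤP
import Data.Integer.Tactic.RingSolver as ℤSolver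
open import Relation.Nullary using (¬_; yes; no)
open import Relation.Binary.Definitions using (tri<; tri≈; tri>)
open import Relation.Binary.PropositionalEquality using (refl; sym; trans; cong; cong₂; subst; subst₂; module ≡-Reasoning)

mutual
  Z : ℕ → ℕ
  Z zero    = 1
  Z (suc k) = 2 * Z k + 5 * W k

  W : ℕ → ℕ
  W zero    = 0
  W (suc k) = 2 * W k + Z k

-- Addition formula: (2+√5)^(a+b) = (2+√5)^a · (2+√5)^b, compared componentwise.
addition : ∀ a b → (Z (a + b) ≡ Z a * Z b + 5 * (W a * W b)) ×
                   (W (a + b) ≡ Z a * W b + W a * Z b)
addition zero b = unit-z (Z b) (W b) , unit-w (Z b) (W b)
  where
  unit-z : ∀ z w → z ≡ 1 * z + 5 * (0 * w)
  unit-z = solve-∀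
  unit-w : ∀ z w → w ≡ 1 * w + 0 * z
  unit-w = solve-∀
addition (suc a) b with addition a b
... | zeq , weq =
  trans (cong₂ (λ p q → 2 * p + 5 * q) zeq weq) (step-z (Z a) (W a) (Z b) (W b)) ,
  trans (cong₂ (λ p q → 2 * q + p) zeq weq) (step-w (Z a) (W a) (Z b) (W b))
  where
  step-z : ∀ za wa zb wb → 2 * (za * zb + 5 * (wa * wb)) + 5 * (za * wb + wa * zb)
                           ≡ (2 * za + 5 * wa) * zb + 5 * ((2 * wa + za) * wb)
  step-z = solve-∀
  step-w : ∀ za wa zb wb → 2 * (za * wb + wa * zb) + (za * zb + 5 * (wa * wb))
                           ≡ (2 * za + 5 * wa) * wb + (2 * wa + za) * zb
  step-w = solve-∀

Z-+ : ∀ a b → Z (a + b) ≡ Z a * Z b + 5 * (W a * W b)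
Z-+ a b = proj₁ (addition a b)

W-+ : ∀ a b → W (a + b) ≡ Z a * W b + W a * Z b
W-+ a b = proj₂ (addition a b)

NormPlus NormMinus PellPair : ℕ → ℕ → Set
NormPlus  a b = a * a ≡ 5 * (b * b) + 1
NormMinus a b = a * a + 1 ≡ 5 * (b * b)
PellPair  a b = NormPlus a b ⊎ NormMinus a b

-- Multiplication by 2 + √5 sends (a, b) to (2a + 5b, 2b + a) and negates the
-- norm; over ℕ this is the identity N(2a + 5b, 2b + a) + N(a, b) = 0:
norm-flip : ∀ a b → (2 * a + 5 * b) * (2 * a + 5 * b) + a * a
                    ≡ 5 * ((2 * b + a) * (2 * b + a)) + 5 * (b * b)
norm-flip = solve-∀

transfer-one : ∀ {X Y u v} → X + u ≡ Y + v → u ≡ v + 1 → X + 1 ≡ Y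
transfer-one {X} {Y} {u} {v} e u≡ = +-cancelʳ-≡ v (X + 1) Y (begin
  X + 1 + v     ≡⟨ +-assoc X 1 v ⟩
  X + (1 + v)   ≡⟨ cong (λ t → X + t) (+-comm 1 v) ⟩
  X + (v + 1)   ≡⟨ cong (λ t → X + t) (sym u≡) ⟩
  X + u         ≡⟨ e ⟩
  Y + v         ∎)
  where open ≡-Reasoning

transfer-one⁻¹ : ∀ {X Y u v} → X + u ≡ Y + v → X + 1 ≡ Y → u ≡ v + 1
transfer-one⁻¹ {X} {Y} {u} {v} e X+1≡Y = +-cancelˡ-≡ X u (v + 1) (begin
  X + u         ≡⟨ e ⟩
  Y + v         ≡⟨ cong (_+ v) (sym X+1≡Y) ⟩
  X + 1 + v     ≡⟨ +-assoc X 1 v ⟩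
  X + (1 + v)   ≡⟨ cong (λ t → X + t) (+-comm 1 v) ⟩
  X + (v + 1)   ∎)
  where open ≡-Reasoning

plus⇒minus : ∀ a b → NormPlus a b → NormMinus (2 * a + 5 * b) (2 * b + a)
plus⇒minus a b = transfer-one (norm-flip a b)

minus⇒plus : ∀ a b → NormMinus a b → NormPlus (2 * a + 5 * b) (2 * b + a)
minus⇒plus a b h = sym (transfer-one (sym (norm-flip a b)) (sym h))

minus⇒plus⁻¹ : ∀ a b → NormMinus (2 * a + 5 * b) (2 * b + a) → NormPlus a b
minus⇒plus⁻¹ a b = transfer-one⁻¹ (norm-flip a b)

plus⇒minus⁻¹ : ∀ a b → NormPlus (2 * a + 5 * b) (2 * b + a) → NormMinus a b
plus⇒minus⁻¹ a b h = sym (transfer-one⁻¹ (sym (norm-flip a b)) (sym h))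

pell-up : ∀ a b → PellPair a b → PellPair (2 * a + 5 * b) (2 * b + a)
pell-up a b (inj₁ h) = inj₂ (plus⇒minus a b h)
pell-up a b (inj₂ h) = inj₁ (minus⇒plus a b h)

pell-down : ∀ a b → PellPair (2 * a + 5 * b) (2 * b + a) → PellPair a b
pell-down a b (inj₁ h) = inj₂ (plus⇒minus⁻¹ a b h)
pell-down a b (inj₂ h) = inj₁ (minus⇒plus⁻¹ a b h)

pell-sequence : ∀ k → PellPair (Z k) (W k)
pell-sequence zero    = inj₁ refl
pell-sequence (suc k) = pell-up (Z k) (W k) (pell-sequence k)

mutual
  norm-even : ∀ t → NormPlus (Z (t + t)) (W (t + t))
  norm-even zero    = refl
  norm-even (suc t) = subst (λ k → NormPlus (Z k) (W k)) (cong suc (sym (+-suc t t)))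
                            (minus⇒plus (Z (suc (t + t))) (W (suc (t + t))) (norm-odd t))

  norm-odd : ∀ t → NormMinus (Z (suc (t + t))) (W (suc (t + t)))
  norm-odd t = plus⇒minus (Z (t + t)) (W (t + t)) (norm-even t)

mutual
  Z-positive : ∀ k → 1 ≤ Z k
  Z-positive zero    = ≤-refl
  Z-positive (suc k) = ≤-trans (Z-positive k) (<⇒≤ (Z-step k))

  Z-step : ∀ k → Z k < Z (suc k)
  Z-step k = begin-strict
    Z k                  <⟨ m<m+n (Z k) (Z-positive k) ⟩
    Z k + Z k            ≡⟨ cong (λ t → Z k + t) (sym (+-identityʳ (Z k))) ⟩
    2 * Z k              ≤⟨ m≤m+n (2 * Z k) (5 * W k) ⟩
    Z (suc k)            ∎
    where open ≤-Reasoning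

Z-mono-< : ∀ {m n} → m < n → Z m < Z n
Z-mono-< {m} m<n = go (≤⇒≤′ m<n)
  where
  go : ∀ {n} → suc m ≤′ n → Z m < Z n
  go ≤′-refl         = Z-step m
  go (≤′-step {n} p) = <-trans (go p) (Z-step n)

Z-mono-≤ : ∀ {m n} → m ≤ n → Z m ≤ Z n
Z-mono-≤ m≤n with m≤n⇒m<n∨m≡n m≤n
... | inj₁ m<n  = <⇒≤ (Z-mono-< m<n)
... | inj₂ refl = ≤-refl

Z-injective : ∀ m n → Z m ≡ Z n → m ≡ n
Z-injective m n eq with <-cmp m n
... | tri< m<n _ _ = ⊥-elim (<-irrefl eq (Z-mono-< m<n))
... | tri≈ _ m≡n _ = m≡n
... | tri> _ _ n<m = ⊥-elim (<-irrefl (sym eq) (Z-mono-< n<m))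

square-cancel-≤ : ∀ x y → x * x ≤ y * y → x ≤ y
square-cancel-≤ x y h with x ≤? y
... | yes x≤y = x≤y
... | no  x≰y = ⊥-elim (<⇒≱ (*-mono-< (≰⇒> x≰y) (≰⇒> x≰y)) h)

pell-sandwich : ∀ a b → PellPair a b → (5 * (b * b) ≤ a * a + 1) × (a * a ≤ 5 * (b * b) + 1)
pell-sandwich a b (inj₁ h) =
  ≤-trans (m≤m+n (5 * (b * b)) 1) (≤-trans (≤-reflexive (sym h)) (m≤m+n (a * a) 1)) ,
  ≤-reflexive h
pell-sandwich a b (inj₂ h) =
  ≤-reflexive (sym h) ,
  ≤-trans (m≤m+n (a * a) 1) (≤-trans (≤-reflexive h) (m≤m+n (5 * (b * b)) 1))

-- For b ≥ 1 a solution satisfies 2b ≤ a ≤ 5b/2, so (5b − 2a, a − 2b) is natural.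
pell-bounds : ∀ a b → 1 ≤ b → PellPair a b → (2 * b ≤ a) × (2 * a ≤ 5 * b)
pell-bounds a b b≥1 h = square-cancel-≤ (2 * b) a lower , square-cancel-≤ (2 * a) (5 * b) upper
  where
  open ≤-Reasoning
  bb≥1 : 1 ≤ b * b
  bb≥1 = *-mono-≤ b≥1 b≥1
  square-2 : ∀ x → 2 * x * (2 * x) ≡ 4 * (x * x)
  square-2 = solve-∀
  four-plus-one : ∀ b → 4 * (b * b) + b * b ≡ 5 * (b * b)
  four-plus-one = solve-∀
  expand : ∀ b → 4 * (5 * (b * b) + 1) ≡ 20 * (b * b) + 4
  expand = solve-∀
  collect : ∀ b → 20 * (b * b) + 5 * (b * b) ≡ 5 * b * (5 * b)
  collect = solve-∀
  lower : 2 * b * (2 * b) ≤ a * a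
  lower = +-cancelʳ-≤ 1 _ _ (begin
    2 * b * (2 * b) + 1         ≡⟨ cong (λ t → t + 1) (square-2 b) ⟩
    4 * (b * b) + 1             ≤⟨ +-monoʳ-≤ (4 * (b * b)) bb≥1 ⟩
    4 * (b * b) + b * b         ≡⟨ four-plus-one b ⟩
    5 * (b * b)                 ≤⟨ proj₁ (pell-sandwich a b h) ⟩
    a * a + 1                   ∎)
  upper : 2 * a * (2 * a) ≤ 5 * b * (5 * b)
  upper = begin
    2 * a * (2 * a)             ≡⟨ square-2 a ⟩
    4 * (a * a)                 ≤⟨ *-monoʳ-≤ 4 (proj₂ (pell-sandwich a b h)) ⟩
    4 * (5 * (b * b) + 1)       ≡⟨ expand b ⟩
    20 * (b * b) + 4            ≤⟨ +-monoʳ-≤ (20 * (b * b)) (≤-trans (n≤1+n 4) (*-monoʳ-≤ 5 bb≥1)) ⟩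
    20 * (b * b) + 5 * (b * b)  ≡⟨ collect b ⟩
    5 * b * (5 * b)             ∎

-- A solution with b ≥ 1 is the image of (5b − 2a, a − 2b) under
-- (a', b') ↦ (2a' + 5b', 2b' + a'), i.e. multiplication by 2 + √5.
pell-predecessor : ∀ a b → 1 ≤ b → PellPair a b →
  ∃[ a' ] ∃[ b' ] (2 * a' + 5 * b' ≡ a) × (2 * b' + a' ≡ b)
pell-predecessor a b b≥1 h = a' , b' , a-from , b-from
  where
  bounds = pell-bounds a b b≥1 h
  a' = 5 * b ∸ 2 * a
  b' = a ∸ 2 * b
  a≡ : 2 * b + b' ≡ a
  a≡ = m+[n∸m]≡n (proj₁ bounds)
  5b≡ : 2 * a + a' ≡ 5 * b
  5b≡ = m+[n∸m]≡n (proj₂ bounds)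
  regroup : ∀ b a' b' → 4 * b + (2 * b' + a') ≡ 2 * (2 * b + b') + a'
  regroup = solve-∀
  split-5 : ∀ b → 5 * b ≡ 4 * b + b
  split-5 = solve-∀
  b-from : 2 * b' + a' ≡ b
  b-from = +-cancelˡ-≡ (4 * b) _ _ (begin
    4 * b + (2 * b' + a')   ≡⟨ regroup b a' b' ⟩
    2 * (2 * b + b') + a'   ≡⟨ cong (λ t → 2 * t + a') a≡ ⟩
    2 * a + a'              ≡⟨ 5b≡ ⟩
    5 * b                   ≡⟨ split-5 b ⟩
    4 * b + b               ∎)
    where open ≡-Reasoning
  regroup′ : ∀ a' b' → 2 * a' + 5 * b' ≡ 2 * (2 * b' + a') + b'
  regroup′ = solve-∀
  a-from : 2 * a' + 5 * b' ≡ a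
  a-from = begin
    2 * a' + 5 * b'          ≡⟨ regroup′ a' b' ⟩
    2 * (2 * b' + a') + b'   ≡⟨ cong (λ t → 2 * t + b') b-from ⟩
    2 * b + b'               ≡⟨ a≡ ⟩
    a                        ∎
    where open ≡-Reasoning

-- The predecessor is strictly smaller in the second coordinate.
half-< : ∀ u v → 1 ≤ 2 * u + v → u < 2 * u + v
half-< zero    v h = h
half-< (suc u) v _ = ≤-trans (m<m+n (suc u) {suc u + 0} (s≤s z≤n)) (m≤m+n (2 * suc u) v)

norm-plus-at-0 : ∀ a → NormPlus a 0 → a ≡ 1
norm-plus-at-0 a h = m*n≡1⇒m≡1 a a h

¬norm-minus-at-0 : ∀ a → ¬ NormMinus a 0
¬norm-minus-at-0 a h with m+n≡0⇒n≡0 (a * a) h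
... | ()

Descends : ℕ → Set
Descends b = ∀ a → PellPair a b → ∃[ k ] (Z k ≡ a) × (W k ≡ b)

descent-step : ∀ b → (∀ {b'} → b' < b → Descends b') → Descends b
descent-step zero    _   a (inj₁ h) = 0 , sym (norm-plus-at-0 a h) , refl
descent-step zero    _   a (inj₂ h) = ⊥-elim (¬norm-minus-at-0 a h)
descent-step (suc b) rec a h = lift (pell-predecessor a (suc b) (s≤s z≤n) h)
  where
  lift : ∃[ a' ] ∃[ b' ] (2 * a' + 5 * b' ≡ a) × (2 * b' + a' ≡ suc b) →
         ∃[ k ] (Z k ≡ a) × (W k ≡ suc b)
  lift (a' , b' , a-from , b-from) with rec b'<b a' h'
    where
    b'<b : b' < suc b
    b'<b = subst (b' <_) b-from (half-< b' a' (subst (1 ≤_) (sym b-from) (s≤s z≤n)))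
    h' : PellPair a' b'
    h' = pell-down a' b' (subst₂ PellPair (sym a-from) (sym b-from) h)
  ... | k , zk , wk = suc k , trans (cong₂ (λ p q → 2 * p + 5 * q) zk wk) a-from ,
                      trans (cong₂ (λ p q → 2 * q + p) zk wk) b-from

descent : ∀ b → Descends b
descent = <-rec Descends descent-step

prime-5 : Prime 5
prime-5 = from-yes (prime? 5)

5∤1 : ¬ 5 ∣ 1
5∤1 = from-no (5 ∣? 1)

prime∣square : ∀ {p m} → Prime p → p ∣ m * m → p ∣ m
prime∣square {m = m} pr d with euclidsLemma m m pr d
... | inj₁ p∣m = p∣m
... | inj₂ p∣m = p∣m

prime^∣*-cancel : ∀ {p} j {x r} → Prime p → ¬ p ∣ r → p ^ j ∣ x * r → p ^ j ∣ x
prime^∣*-cancel zero {x} _ _ _ = 1∣ x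
prime^∣*-cancel {p} (suc j) {x} {r} pr p∤r h with euclidsLemma x r pr (∣-trans (m∣m*n (p ^ j)) h)
... | inj₂ p∣r            = ⊥-elim (p∤r p∣r)
... | inj₁ (divides q refl) =
  subst (p ^ suc j ∣_) (*-comm p q) (*-monoʳ-∣ p (prime^∣*-cancel j pr p∤r pʲ∣qr))
  where
  instance _ = prime⇒nonZero pr
  pʲ∣qr : p ^ j ∣ q * r
  pʲ∣qr = *-cancelˡ-∣ p (subst (p ^ suc j ∣_) (trans (cong (λ t → t * r) (*-comm q p)) (*-assoc p q r)) h)

-- 5 never divides Z a, because Z a² = 5·W a² ± 1.
5∤Z : ∀ a → ¬ 5 ∣ Z a
5∤Z a 5∣z = 5∤1 (excluded (pell-sequence a))
  where
  5∣z² : 5 ∣ Z a * Z a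
  5∣z² = ∣m⇒∣m*n (Z a) 5∣z
  excluded : PellPair (Z a) (W a) → 5 ∣ 1
  excluded (inj₁ h) = ∣m+n∣m⇒∣n (subst (5 ∣_) h 5∣z²) (m∣m*n (W a * W a))
  excluded (inj₂ h) = ∣m+n∣m⇒∣n (subst (5 ∣_) (sym h) (m∣m*n (W a * W a))) 5∣z²

-- The cofactor in W (5a) = 5 · W a · quintic (Z a) (W a).
quintic : ℕ → ℕ → ℕ
quintic z w = z * z * (z * z) + 10 * (z * z * (w * w)) + 5 * (w * w * (w * w))

W-quintuple : ∀ a → W (5 * a) ≡ 5 * (W a * quintic (Z a) (W a))
W-quintuple a = begin
  W (5 * a)                              ≡⟨ cong W (five a) ⟩
  W (a + ((a + a) + (a + a)))            ≡⟨ W-+ a ((a + a) + (a + a)) ⟩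
  z * W ((a + a) + (a + a)) + w * Z ((a + a) + (a + a))
    ≡⟨ cong₂ (λ p q → z * p + w * q) (W-+ (a + a) (a + a)) (Z-+ (a + a) (a + a)) ⟩
  z * (Z (a + a) * W (a + a) + W (a + a) * Z (a + a)) +
  w * (Z (a + a) * Z (a + a) + 5 * (W (a + a) * W (a + a)))
    ≡⟨ cong₂ (λ p q → z * (p * q + q * p) + w * (p * p + 5 * (q * q))) (Z-+ a a) (W-+ a a) ⟩
  z * (z₂ * w₂ + w₂ * z₂) + w * (z₂ * z₂ + 5 * (w₂ * w₂))
    ≡⟨ expand z w ⟩
  5 * (w * quintic z w)                  ∎
  where
  open ≡-Reasoning
  z = Z a
  w = W a
  z₂ = z * z + 5 * (w * w)
  w₂ = z * w + w * z
  five : ∀ a → 5 * a ≡ a + ((a + a) + (a + a))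
  five = solve-∀
  expand : ∀ z w →
    z * ((z * z + 5 * (w * w)) * (z * w + w * z) + (z * w + w * z) * (z * z + 5 * (w * w))) +
    w * ((z * z + 5 * (w * w)) * (z * z + 5 * (w * w)) + 5 * ((z * w + w * z) * (z * w + w * z)))
    ≡ 5 * (w * (z * z * (z * z) + 10 * (z * z * (w * w)) + 5 * (w * w * (w * w))))
  expand = solve-∀

-- quintic z w ≡ z⁴ (mod 5), so 5 ∤ Z a gives 5 ∤ quintic (Z a) (W a).
5∤quintic : ∀ a → ¬ 5 ∣ quintic (Z a) (W a)
5∤quintic a d = 5∤Z a (prime∣square prime-5 (prime∣square prime-5 5∣z⁴))
  where
  z = Z a
  w = W a
  mod-5 : ∀ z w → z * z * (z * z) + 10 * (z * z * (w * w)) + 5 * (w * w * (w * w))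
                  ≡ 5 * (2 * (z * z * (w * w)) + w * w * (w * w)) + z * z * (z * z)
  mod-5 = solve-∀
  5∣z⁴ : 5 ∣ z * z * (z * z)
  5∣z⁴ = ∣m+n∣m⇒∣n (subst (5 ∣_) (mod-5 z w) d) (m∣m*n (2 * (z * z * (w * w)) + w * w * (w * w)))

W-shift-5 : ∀ k → W (5 + k) ≡ 682 * W k + 305 * Z k
W-shift-5 k = W-+ 5 k

-- 5 ∣ W k forces 5 ∣ k: W (5 + k) = 682·W k + 305·Z k with 5 ∤ 682 and 5 ∣ 305,
-- and W 1, …, W 4 = 1, 4, 17, 72 are not divisible by 5.
5∣W⇒5∣index : ∀ k → 5 ∣ W k → 5 ∣ k
5∣W⇒5∣index 0 _ = 5 ∣0
5∣W⇒5∣index 1 d = ⊥-elim (5∤1 d)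
5∣W⇒5∣index 2 d = ⊥-elim (from-no (5 ∣? 4) d)
5∣W⇒5∣index 3 d = ⊥-elim (from-no (5 ∣? 17) d)
5∣W⇒5∣index 4 d = ⊥-elim (from-no (5 ∣? 72) d)
5∣W⇒5∣index (suc (suc (suc (suc (suc k))))) d = ∣m∣n⇒∣m+n (∣-refl {5}) (5∣W⇒5∣index k 5∣Wk)
  where
  5∣305Zk : 5 ∣ 305 * Z k
  5∣305Zk = ∣m⇒∣m*n (Z k) (divides 61 refl)
  5∣682Wk : 5 ∣ 682 * W k
  5∣682Wk = ∣m+n∣m⇒∣n (subst (5 ∣_) (+-comm (682 * W k) (305 * Z k)) (subst (5 ∣_) (W-shift-5 k) d)) 5∣305Zk
  5∣Wk : 5 ∣ W k
  5∣Wk = prime^∣*-cancel 1 prime-5 (from-no (5 ∣? 682)) (subst (5 ∣_) (*-comm 682 (W k)) 5∣682Wk)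

5^∣W⇒5^∣index : ∀ j k → 5 ^ j ∣ W k → 5 ^ j ∣ k
5^∣W⇒5^∣index zero    k _ = 1∣ k
5^∣W⇒5^∣index (suc j) k h with 5∣W⇒5∣index k (∣-trans (m∣m*n (5 ^ j)) h)
... | divides q refl =
  subst (5 ^ suc j ∣_) (*-comm 5 q) (*-monoʳ-∣ 5 (5^∣W⇒5^∣index j q 5ʲ∣Wq))
  where
  5ʲ∣Wq : 5 ^ j ∣ W q
  5ʲ∣Wq = prime^∣*-cancel j prime-5 (5∤quintic q)
            (*-cancelˡ-∣ 5 (subst (5 ^ suc j ∣_) (trans (cong W (*-comm q 5)) (W-quintuple q)) h))

W-∣-multiple : ∀ a t → W a ∣ W (a * t)
W-∣-multiple a zero    = subst (λ k → W a ∣ W k) (sym (*-zeroʳ a)) (W a ∣0)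
W-∣-multiple a (suc t) = subst (λ k → W a ∣ W k) (sym (*-suc a t))
  (subst (W a ∣_) (sym (W-+ a (a * t)))
    (∣m∣n⇒∣m+n (∣n⇒∣m*n (Z a) (W-∣-multiple a t)) (∣m⇒∣m*n (Z (a * t)) ∣-refl)))

5^∣W[5^] : ∀ e → 5 ^ e ∣ W (5 ^ e)
5^∣W[5^] zero    = 1∣ 1
5^∣W[5^] (suc e) = subst (5 ^ suc e ∣_) (sym (W-quintuple (5 ^ e)))
  (*-monoʳ-∣ 5 (∣m⇒∣m*n (quintic (Z (5 ^ e)) (W (5 ^ e))) (5^∣W[5^] e)))

-- If a² + 1 = 5b² and 5^e ∣ b, then (a, b) = (Z k, W k) with 5^e ∣ k and k ≠ 0,
-- so a ≥ Z (5^e).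
pell-lower-bound : ∀ e a b → NormMinus a b → 5 ^ e ∣ b → Z (5 ^ e) ≤ a
pell-lower-bound e a b h 5ᵉ∣b with descent b a (inj₂ h)
... | zero  , refl , refl = ⊥-elim (¬norm-minus-at-0 1 h)
... | suc k , refl , refl = Z-mono-≤ (∣⇒≤ (5^∣W⇒5^∣index e (suc k) 5ᵉ∣b))

family-index : ℕ → ℕ → ℕ
family-index e j = 5 ^ e * suc (j + j)

odd-power-5 : ∀ e → ∃[ h ] 5 ^ e ≡ suc (h + h)
odd-power-5 zero    = 0 , refl
odd-power-5 (suc e) with odd-power-5 e
... | h , eq = 2 + 5 * h , trans (cong (5 *_) eq) (five-times h)
  where
  five-times : ∀ h → 5 * suc (h + h) ≡ suc ((2 + 5 * h) + (2 + 5 * h))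
  five-times = solve-∀

family-index-odd : ∀ e j → ∃[ t ] family-index e j ≡ suc (t + t)
family-index-odd e j with odd-power-5 e
... | h , 5ᵉ≡ = h + j + 2 * (h * j) , trans (cong (λ u → u * suc (j + j)) 5ᵉ≡) (odd-product h j)
  where
  odd-product : ∀ h j → suc (h + h) * suc (j + j)
                        ≡ suc ((h + j + 2 * (h * j)) + (h + j + 2 * (h * j)))
  odd-product = solve-∀

family-index-injective : ∀ e i j → family-index e i ≡ family-index e j → i ≡ j
family-index-injective e i j eq =
  *-cancelˡ-≡ i j 2 (trans (double i) (trans (suc-injective 2i+1≡2j+1) (sym (double j))))
  where
  instance _ = m^n≢0 5 e
  2i+1≡2j+1 : suc (i + i) ≡ suc (j + j)
  2i+1≡2j+1 = *-cancelˡ-≡ (suc (i + i)) (suc (j + j)) (5 ^ e) eq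
  double : ∀ m → 2 * m ≡ m + m
  double = solve-∀

family-norm : ∀ e j → NormMinus (Z (family-index e j)) (W (family-index e j))
family-norm e j with family-index-odd e j
... | t , eq = subst (λ k → NormMinus (Z k) (W k)) (sym eq) (norm-odd t)

family-div : ∀ e j → 5 ^ e ∣ W (family-index e j)
family-div e j = ∣-trans (5^∣W[5^] e) (W-∣-multiple (5 ^ e) (suc (j + j)))

unit⁺ unit⁻ : ℤ√5
unit⁺ = + 2 +√5· + 1
unit⁻ = + 2 +√5· ℤ.- (+ 1)

embed-z : ∀ z w → + 2 ℤ.* + z ℤ.+ + 5 ℤ.* (+ 1 ℤ.* + w) ≡ + (2 * z + 5 * w)
embed-z z w = begin
  + 2 ℤ.* + z ℤ.+ + 5 ℤ.* (+ 1 ℤ.* + w)  ≡⟨ cong (λ t → + 2 ℤ.* + z ℤ.+ + 5 ℤ.* t) (ℤP.*-identityˡ (+ w)) ⟩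
  + 2 ℤ.* + z ℤ.+ + 5 ℤ.* + w            ≡⟨ sym (cong₂ ℤ._+_ (ℤP.pos-* 2 z) (ℤP.pos-* 5 w)) ⟩
  + (2 * z) ℤ.+ + (5 * w)                ≡⟨ sym (ℤP.pos-+ (2 * z) (5 * w)) ⟩
  + (2 * z + 5 * w)                      ∎
  where open ≡-Reasoning

embed-w : ∀ z w → + 2 ℤ.* + w ℤ.+ + 1 ℤ.* + z ≡ + (2 * w + z)
embed-w z w = begin
  + 2 ℤ.* + w ℤ.+ + 1 ℤ.* + z  ≡⟨ cong₂ ℤ._+_ (sym (ℤP.pos-* 2 w)) (ℤP.*-identityˡ (+ z)) ⟩
  + (2 * w) ℤ.+ + z            ≡⟨ sym (ℤP.pos-+ (2 * w) z) ⟩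
  + (2 * w + z)                ∎
  where open ≡-Reasoning

unit⁺-step : ∀ z w → unit⁺ ⊗ (+ z +√5· + w) ≡ (+ (2 * z + 5 * w) +√5· + (2 * w + z))
unit⁺-step z w = cong₂ _+√5·_ (embed-z z w) (embed-w z w)

unit⁻-step : ∀ z w → unit⁻ ⊗ (+ z +√5· ℤ.- + w) ≡ (+ (2 * z + 5 * w) +√5· ℤ.- + (2 * w + z))
unit⁻-step z w = cong₂ _+√5·_ (trans (conj-re (+ z) (+ w)) (embed-z z w))
                               (trans (conj-im (+ z) (+ w)) (cong ℤ.-_ (embed-w z w)))
  where
  conj-re : ∀ z w → + 2 ℤ.* z ℤ.+ + 5 ℤ.* (ℤ.- (+ 1) ℤ.* ℤ.- w) ≡ + 2 ℤ.* z ℤ.+ + 5 ℤ.* (+ 1 ℤ.* w)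
  conj-re = ℤSolver.solve-∀
  conj-im : ∀ z w → + 2 ℤ.* ℤ.- w ℤ.+ ℤ.- (+ 1) ℤ.* z ≡ ℤ.- (+ 2 ℤ.* w ℤ.+ + 1 ℤ.* z)
  conj-im = ℤSolver.solve-∀

unit⁺-pow : ∀ k → unit⁺ ^√ k ≡ (+ Z k +√5· + W k)
unit⁺-pow zero    = refl
unit⁺-pow (suc k) = trans (cong (unit⁺ ⊗_) (unit⁺-pow k)) (unit⁺-step (Z k) (W k))

unit⁻-pow : ∀ k → unit⁻ ^√ k ≡ (+ Z k +√5· ℤ.- + W k)
unit⁻-pow zero    = refl
unit⁻-pow (suc k) = trans (cong (unit⁻ ⊗_) (unit⁻-pow k)) (unit⁻-step (Z k) (W k))

lucasSum-re : ∀ m → re (lucasSum m) ≡ + (Z m + Z m)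
lucasSum-re m = trans (cong₂ (λ u v → re u ℤ.+ re v) (unit⁺-pow m) (unit⁻-pow m))
                      (sym (ℤP.pos-+ (Z m) (Z m)))

lucasSum-im : ∀ m → im (lucasSum m) ≡ + 0
lucasSum-im m = trans (cong₂ (λ u v → im u ℤ.+ im v) (unit⁺-pow m) (unit⁻-pow m))
                      (ℤP.+-inverseʳ (+ W m))

pow-double : ∀ b i → b ^ (2 ^ suc i) ≡ b ^ (2 ^ i) * b ^ (2 ^ i)
pow-double b i = trans (cong (b ^_) (double (2 ^ i))) (^-distribˡ-+-* b (2 ^ i) (2 ^ i))
  where
  double : ∀ m → 2 * m ≡ m + m
  double = solve-∀

scaled-norm : ∀ c B → 5 * (c * c) * (B * B) ≡ 5 * ((B * c) * (B * c))
scaled-norm = solve-∀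

square-abs : ∀ u → u ℤ.* u ≡ + (ℤ.∣ u ∣ * ℤ.∣ u ∣)
square-abs (+ n)      = sym (ℤP.pos-* n n)
square-abs ℤ.-[1+ n ] = refl

sum-value : ∀ {u v w p q} → u ≡ + p → v ≡ + q → u ℤ.+ v ≡ w → w ≡ + (p + q)
sum-value {p = p} {q} refl refl eq = trans (sym eq) (sym (ℤP.pos-+ p q))

prod-value : ∀ {u v w p q} → u ≡ + p → v ≡ + q → u ℤ.* v ≡ w → w ≡ + (p * q)
prod-value {p = p} {q} refl refl eq = trans (sym eq) (sym (ℤP.pos-* p q))

square-value : ∀ u {w} → u ℤ.* u ≡ w → w ≡ + (ℤ.∣ u ∣ * ℤ.∣ u ∣)
square-value u eq = trans (sym eq) (square-abs u)

sum-entries : ∀ {u v w p q r} → u ≡ + p → v ≡ + q → w ≡ + r → p + q ≡ r → u ℤ.+ v ≡ w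
sum-entries {p = p} {q} refl refl refl refl = sym (ℤP.pos-+ p q)

prod-entries : ∀ {u v w p q r} → u ≡ + p → v ≡ + q → w ≡ + r → p * q ≡ r → u ℤ.* v ≡ w
prod-entries {p = p} {q} refl refl refl refl = sym (ℤP.pos-* p q)

system-x₁ : ∀ n x → System n x → x ‼ 1 ≡ + 5
system-x₁ n x (_ , _ , x₃ , e₄ , e₅ , e₁ , _) = sum-value x₅ x₃ e₁
  where
  x₄ = sum-value x₃ x₃ e₄
  x₅ = sum-value x₄ x₄ e₅

system-powers : ∀ n x → System n x → ∀ i → i ≤ n → x ‼ suc i ≡ + (5 ^ (2 ^ i))
system-powers n x sys zero    _  = system-x₁ n x sys
system-powers n x sys (suc i) le =
  trans (prod-value xᵢ xᵢ (proj₁ sys (suc i) (s≤s z≤n) le)) (cong +_ (sym (pow-double 5 i)))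
  where
  xᵢ = system-powers n x sys i (≤-trans (n≤1+n i) le)

lucas-square-bound : ∀ m A → Z m ≤ A →
  re (lucasSum m) ℤ.* re (lucasSum m) ℤ.+ + 4 ℤ.≤ + 4 ℤ.* + (A * A + 1)
lucas-square-bound m A Zm≤A = begin
  re (lucasSum m) ℤ.* re (lucasSum m) ℤ.+ + 4
    ≡⟨ cong (λ r → r ℤ.* r ℤ.+ + 4) (lucasSum-re m) ⟩
  + (Z m + Z m) ℤ.* + (Z m + Z m) ℤ.+ + 4
    ≡⟨ cong (λ r → r ℤ.+ + 4) (sym (ℤP.pos-* (Z m + Z m) (Z m + Z m))) ⟩
  + ((Z m + Z m) * (Z m + Z m)) ℤ.+ + 4
    ≡⟨ sym (ℤP.pos-+ ((Z m + Z m) * (Z m + Z m)) 4) ⟩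
  + ((Z m + Z m) * (Z m + Z m) + 4)
    ≤⟨ ℤ.+≤+ natural-bound ⟩
  + (4 * (A * A + 1))
    ≡⟨ ℤP.pos-* 4 (A * A + 1) ⟩
  + 4 ℤ.* + (A * A + 1)  ∎
  where
  open ℤP.≤-Reasoning
  lhs : ∀ z → (z + z) * (z + z) + 4 ≡ 4 * (z * z) + 4
  lhs = solve-∀
  rhs : ∀ a → 4 * (a * a + 1) ≡ 4 * (a * a) + 4
  rhs = solve-∀
  natural-bound : (Z m + Z m) * (Z m + Z m) + 4 ≤ 4 * (A * A + 1)
  natural-bound = subst₂ _≤_ (sym (lhs (Z m))) (sym (rhs A))
    (+-monoˡ-≤ 4 (*-monoʳ-≤ 4 (*-mono-≤ Zm≤A Zm≤A)))

-- With c = 5^(2^(n−1)), A = |x_{n+8}|, B = |x_{n+6}|: the system gives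
-- x_{n+10} = A² + 1 = 5(B·c)², so A ≥ Z c by the Pell lower bound.
system-lower-bound : ∀ n' x → System (suc n') x →
  let S = lucasSum (5 ^ (2 ^ n')) in
  (im S ≡ + 0) × (re S ℤ.* re S ℤ.+ + 4 ℤ.≤ + 4 ℤ.* x ‼ (suc n' + 10))
system-lower-bound n' x sys@(_ , e₂ , x₃ , _ , _ , _ , e₇ , e₈ , e₉ , e₁₀) =
  lucasSum-im c ,
  subst (λ v → re (lucasSum c) ℤ.* re (lucasSum c) ℤ.+ + 4 ℤ.≤ + 4 ℤ.* v) (sym x₁₀)
    (lucas-square-bound c A (pell-lower-bound (2 ^ n') A (B * c) norm (n∣m*n B)))
  where
  n = suc n'
  c = 5 ^ (2 ^ n')
  A = ℤ.∣ x ‼ (n + 8) ∣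
  B = ℤ.∣ x ‼ (n + 6) ∣
  xₙ₊₁ : x ‼ (n + 1) ≡ + (c * c)
  xₙ₊₁ = trans (cong (x ‼_) (+-comm n 1))
               (trans (system-powers n x sys n ≤-refl) (cong +_ (pow-double 5 n')))
  xₙ₊₂ : x ‼ (n + 2) ≡ + (5 * (c * c))
  xₙ₊₂ = prod-value (system-x₁ n x sys) xₙ₊₁ e₂
  x₁₀ : x ‼ (n + 10) ≡ + (A * A + 1)
  x₁₀ = sum-value (square-value (x ‼ (n + 8)) e₈) x₃ e₉
  norm : NormMinus A (B * c)
  norm = trans (ℤP.+-injective (trans (sym x₁₀) (prod-value xₙ₊₂ (square-value (x ‼ (n + 6)) e₇) e₁₀)))
               (scaled-norm c B)

-- A non-negative tuple (x₁, …, x_m) given by its 1-based entries, read back by _‼_.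
tuple : ∀ {m} → (ℕ → ℕ) → Fin m → ℕ
tuple g t = g (suc (toℕ t))

tuple-‼ : ∀ {m} (g : ℕ → ℕ) i → 1 ≤ i → i ≤ m → toℤ {m} (tuple g) ‼ i ≡ + g i
tuple-‼ {m} g (suc i) _ i<m with i <? m
... | yes p = cong (λ v → + g (suc v)) (toℕ-fromℕ< p)
... | no ¬p = ⊥-elim (¬p i<m)

‼-cong : ∀ {m} {x y : Fin m → ℤ} → (∀ t → x t ≡ y t) → ∀ i → x ‼ i ≡ y ‼ i
‼-cong         eq zero    = refl
‼-cong {m} eq (suc i) with i <? m
... | yes p = eq (fromℕ< p)
... | no _  = refl

-- The entries x_{n+2}, …, x_{n+10} = 5c², 1, 2, 4, B, B², A, A², A² + 1.
tail-entry : (c B A : ℕ) → ℕ → ℕ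
tail-entry c B A 1 = 5 * (c * c)
tail-entry c B A 2 = 1
tail-entry c B A 3 = 2
tail-entry c B A 4 = 4
tail-entry c B A 5 = B
tail-entry c B A 6 = B * B
tail-entry c B A 7 = A
tail-entry c B A 8 = A * A
tail-entry c B A 9 = A * A + 1
tail-entry c B A _ = 0

solution-entry : (n c B A : ℕ) → ℕ → ℕ
solution-entry n c B A i with i ≤? suc n
... | yes _ = 5 ^ (2 ^ (i ∸ 1))
... | no _  = tail-entry c B A (i ∸ suc n)

solution : (n c B A : ℕ) → Fin (n + 10) → ℤ
solution n c B A = toℤ (tuple (solution-entry n c B A))

in-range : ∀ n i → i ≤ suc n → i ≤ n + 10
in-range n i i≤n+1 = ≤-trans i≤n+1 (subst (_≤ n + 10) (+-comm n 1) (+-monoʳ-≤ n (s≤s z≤n)))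

solution-head : ∀ n c B A i → 1 ≤ i → i ≤ suc n → solution n c B A ‼ i ≡ + (5 ^ (2 ^ (i ∸ 1)))
solution-head n c B A i 1≤i i≤n+1 =
  trans (tuple-‼ (solution-entry n c B A) i 1≤i (in-range n i i≤n+1)) (cong +_ head)
  where
  head : solution-entry n c B A i ≡ 5 ^ (2 ^ (i ∸ 1))
  head with i ≤? suc n
  ... | yes _ = refl
  ... | no i≰ = ⊥-elim (i≰ i≤n+1)

solution-tail : ∀ n c B A k {k≤8 : True (k ≤? 8)} →
  solution n c B A ‼ (n + suc (suc k)) ≡ + tail-entry c B A (suc k)
solution-tail n c B A k {k≤8} =
  trans (tuple-‼ (solution-entry n c B A) (n + suc (suc k)) (≤-trans (s≤s z≤n) (m≤n+m _ n))
                 (+-monoʳ-≤ n (s≤s (s≤s (toWitness k≤8)))))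
        (cong +_ tail)
  where
  n+2≤ : suc (suc n) ≤ n + suc (suc k)
  n+2≤ = subst (_≤ n + suc (suc k)) (+-comm n 2) (+-monoʳ-≤ n (s≤s (s≤s z≤n)))
  tail : solution-entry n c B A (n + suc (suc k)) ≡ tail-entry c B A (suc k)
  tail with n + suc (suc k) ≤? suc n
  ... | yes le = ⊥-elim (<-irrefl refl (≤-trans n+2≤ le))
  ... | no _   = cong (tail-entry c B A)
                      (trans (cong (_∸ suc n) (+-suc n (suc k))) (m+n∸m≡n (suc n) (suc k)))

solution-system : ∀ n' B A → 5 * (5 ^ (2 ^ n') * 5 ^ (2 ^ n')) * (B * B) ≡ A * A + 1 →
  System (suc n') (solution (suc n') (5 ^ (2 ^ n')) B A)
solution-system n' B A pell =
  chain , first , at 1 ,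
  sum-entries (at 1) (at 1) (at 2) refl ,
  sum-entries (at 2) (at 2) (at 3) refl ,
  sum-entries (at 3) (at 1) (head 1 (s≤s z≤n) (s≤s z≤n)) refl ,
  prod-entries (at 4) (at 4) (at 5) refl ,
  prod-entries (at 6) (at 6) (at 7) refl ,
  sum-entries (at 7) (at 1) (at 8) refl ,
  prod-entries (at 0) (at 5) (at 8) pell
  where
  n = suc n'
  c = 5 ^ (2 ^ n')
  head = solution-head n c B A
  at = solution-tail n c B A
  chain : ∀ i → 1 ≤ i → i ≤ n →
    solution n c B A ‼ i ℤ.* solution n c B A ‼ i ≡ solution n c B A ‼ suc i
  chain (suc i) 1≤i i≤n = prod-entries xᵢ xᵢ (head (suc (suc i)) (s≤s z≤n) (s≤s i≤n)) (sym (pow-double 5 i))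
    where xᵢ = head (suc i) 1≤i (≤-trans i≤n (n≤1+n n))
  first : solution n c B A ‼ 1 ℤ.* solution n c B A ‼ (n + 1) ≡ solution n c B A ‼ (n + 2)
  first = prod-entries (head 1 (s≤s z≤n) (s≤s z≤n)) (head (n + 1) (s≤s z≤n) (≤-reflexive (+-comm n 1))) (at 0)
    (cong (5 *_) (trans (cong (λ e → 5 ^ (2 ^ e)) (+-comm n' 1)) (pow-double 5 n')))

-- Parameters from the Pell family: A = Z k and B·c = W k for k = c·(2j + 1).
system-solutions : ∀ n' → Σ (ℕ → (Fin (suc n' + 10) → ℕ)) λ f →
  (∀ j → System (suc n') (toℤ (f j))) × (∀ i j → (∀ t → f i t ≡ f j t) → i ≡ j)
system-solutions n' = f , (λ j → solution-system n' (B j) (A j) (pell j)) , injective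
  where
  e = 2 ^ n'
  c = 5 ^ e
  A B : ℕ → ℕ
  A j = Z (family-index e j)
  B j = _∣_.quotient (family-div e j)
  f : ℕ → Fin (suc n' + 10) → ℕ
  f j = tuple (solution-entry (suc n') c (B j) (A j))
  pell : ∀ j → 5 * (c * c) * (B j * B j) ≡ A j * A j + 1
  pell j = begin
    5 * (c * c) * (B j * B j)        ≡⟨ scaled-norm c (B j) ⟩
    5 * ((B j * c) * (B j * c))      ≡⟨ cong (λ w → 5 * (w * w)) (sym (_∣_.equality (family-div e j))) ⟩
    5 * (W k * W k)                  ≡⟨ sym (family-norm e j) ⟩
    A j * A j + 1                    ∎
    where
    open ≡-Reasoning
    k = family-index e j
  -- Distinct parameters j give distinct entries x_{n+8} = Z (c·(2j + 1)).
  injective : ∀ i j → (∀ t → f i t ≡ f j t) → i ≡ j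
  injective i j eq = family-index-injective e i j (Z-injective _ _ (ℤP.+-injective (begin
    + A i                                       ≡⟨ sym (xₙ₊₈ i) ⟩
    solution (suc n') c (B i) (A i) ‼ (suc n' + 8)  ≡⟨ ‼-cong (λ t → cong +_ (eq t)) (suc n' + 8) ⟩
    solution (suc n') c (B j) (A j) ‼ (suc n' + 8)  ≡⟨ xₙ₊₈ j ⟩
    + A j                                       ∎)))
    where
    open ≡-Reasoning
    xₙ₊₈ : ∀ j → solution (suc n') c (B j) (A j) ‼ (suc n' + 8) ≡ + A j
    xₙ₊₈ j = solution-tail (suc n') c (B j) (A j) 6

theorem4 : (n : ℕ) → 1 ≤ n →
    (Σ (ℕ → (Fin (n ℕ.+ 10) → ℕ)) λ f →
       (∀ k → System n (toℤ (f k))) ×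
       (∀ j k → (∀ t → f j t ≡ f k t) → j ≡ k)) ×
    ((x : Fin (n ℕ.+ 10) → ℤ) → System n x →
       let S = lucasSum (5 ^ (2 ^ (n ∸ 1))) in
       (im S ≡ + 0) × (re S ℤ.* re S ℤ.+ + 4 ℤ.≤ + 4 ℤ.* x ‼ (n ℕ.+ 10)))
theorem4 zero     ()
theorem4 (suc n') _ = system-solutions n' , system-lower-bound n'
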